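{- Let $p$ be a prime, let $t$ be any integer, and let $(i_1,\ldots,i_r)$ be an ordered $r$-tuple of nonnegative integers with $\sum_j i_j\le p^{\nu_p(t)}$. Then $$\nu_p\binom{t}{t-\sum_j i_j,\,i_1,\ldots,i_r}=\nu_p(t)+\nu_p\binom{\sum_j i_j}{i_1,\ldots,i_r}-\nu_p\Big(\sum_j i_j\Big).$$
   Context: $\nu_p(q)$ denotes the exponent of $p$ in a rational number $q$. For any integer $t$ and $s=\sum_j i_j$, the generalized multinomial coefficient is $\binom{t}{t-s,\,i_1,\ldots,i_r}:=\frac{t(t-1)\cdots(t+1-s)}{i_1!\cdots i_r!}$, and $\binom{s}{i_1,\ldots,i_r}:=\frac{s!}{i_1!\cdots i_r!}$. -}

module Defs where

open import Data.Nat as ℕ using (ℕ; zero; suc; _!; NonZero)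
open import Data.Nat.Properties using (m*n≢0; _!≢0)
open import Data.Nat.Divisibility using (_∣?_; divides)
open import Data.Integer as ℤ using (ℤ; +_; ∣_∣)
open import Data.Rational as ℚ using (ℚ)
open ℚ.ℚ using (numerator; denominatorℕ)
open import Data.Vec using (Vec; []; _∷_; sum)
open import Relation.Nullary using (yes; no)

-- p-adic valuation of a natural number: number of times p divides n
-- (computed with fuel n, which suffices for p ≥ 2; ν p 0 = 0 is junk,
-- never used in the statement).
νℕ-go : ℕ → ℕ → ℕ → ℕ
νℕ-go p zero    n = 0
νℕ-go p (suc f) zero = 0
νℕ-go p (suc f) (suc n) with p ∣? suc n
... | yes (divides q _) = suc (νℕ-go p f q)
... | no _ = 0

νℕ : ℕ → ℕ → ℕ
νℕ p n = νℕ-go p n n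

νℤ : ℕ → ℤ → ℕ
νℤ p t = νℕ p ∣ t ∣

νℚ : ℕ → ℚ → ℤ
νℚ p q = (+ νℕ p ∣ numerator q ∣) ℤ.- (+ νℕ p (denominatorℕ q))

prodFact : ∀ {r} → Vec ℕ r → ℕ
prodFact []       = 1
prodFact (i ∷ is) = i ! ℕ.* prodFact is

prodFact≢0 : ∀ {r} (is : Vec ℕ r) → NonZero (prodFact is)
prodFact≢0 []       = _
prodFact≢0 (i ∷ is) = m*n≢0 (i !) (prodFact is) {{i !≢0}} {{prodFact≢0 is}}

falling : ℤ → ℕ → ℤ
falling t zero    = + 1
falling t (suc s) = falling t s ℤ.* (t ℤ.- + s)

-- generalized multinomial coefficient  binom(t; t-s, i₁,…,i_r), s = Σ i_j
genMultinom : ∀ {r} → ℤ → Vec ℕ r → ℚ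
genMultinom t is = ℚ._/_ (falling t (sum is)) (prodFact is) {{prodFact≢0 is}}

multinom : ∀ {r} → Vec ℕ r → ℚ
multinom is = ℚ._/_ (+ (sum is !)) (prodFact is) {{prodFact≢0 is}}

module Submission where

-- Write ∣t∣ = pᵛ·m with p ∤ m, so v = ν(t), and let S = Σ i_j.
-- For 1 ≤ k < pᵛ we have ν(k) < v, hence by the "ultrametric" property
-- ν(t - k) = ν(k).  The falling factorial t(t-1)⋯(t+1-S) therefore has
-- valuation v + Σ_{k<S} ν(k) = v + ν((S-1)!) = v + ν(S!) - ν(S).  Since both
-- multinomial coefficients are quotients by the same i₁!⋯i_r!, and the
-- valuation of a quotient is the difference of valuations, the claim follows.

open import Defs
open import Data.Nat using (ℕ)
open import Data.Nat.Primality using (Prime)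

module Valuation (p : ℕ) (p-prime : Prime p) where
  open import Data.Nat
  open import Data.Nat.Properties
  open import Data.Nat.Divisibility
  open import Data.Nat.Primality
  open import Data.Product using (_×_; _,_; ∃-syntax)
  open import Data.Sum using (inj₁; inj₂)
  open import Data.Empty using (⊥-elim)
  open import Relation.Nullary using (¬_; yes; no)
  open import Relation.Binary.PropositionalEquality
  open import Data.Nat.Solver using (module +-*-Solver)
  open +-*-Solver using (solve; _:*_; _:=_)

  instance
    p-nonZero : NonZero p
    p-nonZero = prime⇒nonZero p-prime

    p-nonTrivial : NonTrivial p
    p-nonTrivial = prime⇒nonTrivial p-prime

  record _HasValuation_ (n e : ℕ) : Set where
    constructor factor
    field
      unit      : ℕ
      p∤unit    : ¬ (p ∣ unit)
      factorise : n ≡ p ^ e * unit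

  p∤⇒≢0 : ∀ {m} → ¬ (p ∣ m) → m ≢ 0
  p∤⇒≢0 p∤m refl = p∤m (p ∣0)

  HasValuation⇒≢0 : ∀ {n e} → n HasValuation e → n ≢ 0
  HasValuation⇒≢0 {e = e} (factor m p∤m refl) pᵉm≡0 with m*n≡0⇒m≡0∨n≡0 (p ^ e) pᵉm≡0
  ... | inj₁ pᵉ≡0 = ≢-nonZero⁻¹ p (m^n≡0⇒m≡0 p e pᵉ≡0)
  ... | inj₂ m≡0  = p∤⇒≢0 p∤m m≡0

  peel : ∀ e m → p ^ suc e * m ≡ p ^ e * m * p
  peel e m = trans (*-assoc p (p ^ e) m) (*-comm p (p ^ e * m))

  -- The quotient of n by p is smaller than n: this makes the fuel of νℕ-go suffice.
  quotient-fits : ∀ {n q f} → suc n ≡ q * p → suc n ≤ suc f → q ≤ f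
  quotient-fits {n} eq n<f = ≤-pred (≤-trans (quotient-< (divides {n = suc n} _ eq)) n<f)

  ν-go-exact : ∀ f {n e} → n HasValuation e → n ≤ f → νℕ-go p f n ≡ e
  ν-go-exact f {zero} n-val _ = ⊥-elim (HasValuation⇒≢0 n-val refl)
  ν-go-exact zero {suc n} _ ()
  ν-go-exact (suc f) {suc n} n-val n≤f with p ∣? suc n
  ν-go-exact (suc f) {suc n} {zero} (factor m p∤m n≡) n≤f | yes p∣n =
    ⊥-elim (p∤m (subst (p ∣_) (trans n≡ (*-identityˡ m)) p∣n))
  ν-go-exact (suc f) {suc n} {suc e} (factor m p∤m n≡) n≤f | yes (divides q eq) =
    cong suc (ν-go-exact f (factor m p∤m q≡pᵉm) (quotient-fits eq n≤f))
    where
    q≡pᵉm : q ≡ p ^ e * m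
    q≡pᵉm = *-cancelʳ-≡ q (p ^ e * m) p (trans (sym eq) (trans n≡ (peel e m)))
  ν-go-exact (suc f) {suc n} {zero}  _ n≤f | no _ = refl
  ν-go-exact (suc f) {suc n} {suc e} (factor m p∤m n≡) n≤f | no p∤n =
    ⊥-elim (p∤n (divides (p ^ e * m) (trans n≡ (peel e m))))

  ν-go-decomposes : ∀ f n → n ≤ f → n ≢ 0 → n HasValuation νℕ-go p f n
  ν-go-decomposes f zero _ n≢0 = ⊥-elim (n≢0 refl)
  ν-go-decomposes zero (suc n) () _
  ν-go-decomposes (suc f) (suc n) n≤f _ with p ∣? suc n
  ... | no p∤n = factor (suc n) p∤n (sym (*-identityˡ (suc n)))
  ... | yes (divides q eq)
    with ν-go-decomposes f q (quotient-fits eq n≤f) (λ { refl → 0≢1+n (sym eq) })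
  ...   | factor m p∤m q≡ =
            factor m p∤m (trans eq (trans (cong (_* p) q≡) (sym (peel (νℕ-go p f q) m))))

  ν-exact : ∀ {n e} → n HasValuation e → νℕ p n ≡ e
  ν-exact {n} n-val = ν-go-exact n n-val ≤-refl

  ν-decomposes : ∀ n → n ≢ 0 → n HasValuation νℕ p n
  ν-decomposes n = ν-go-decomposes n n ≤-refl

  HasValuation-* : ∀ {a b x y} → a HasValuation x → b HasValuation y →
                   (a * b) HasValuation (x + y)
  HasValuation-* {x = x} {y} (factor m p∤m refl) (factor n p∤n refl) = factor (m * n) p∤mn regroup
    where
    p∤mn : ¬ (p ∣ m * n)
    p∤mn p∣mn with euclidsLemma m n p-prime p∣mn
    ... | inj₁ p∣m = p∤m p∣m
    ... | inj₂ p∣n = p∤n p∣n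
    regroup : p ^ x * m * (p ^ y * n) ≡ p ^ (x + y) * (m * n)
    regroup = begin
      p ^ x * m * (p ^ y * n)   ≡⟨ solve 4 (λ a u b w → (a :* u) :* (b :* w) := (a :* b) :* (u :* w))
                                         refl (p ^ x) m (p ^ y) n ⟩
      p ^ x * p ^ y * (m * n)   ≡⟨ cong (_* (m * n)) (sym (^-distribˡ-+-* p x y)) ⟩
      p ^ (x + y) * (m * n)     ∎
      where open ≡-Reasoning

  ν-* : ∀ a b → a ≢ 0 → b ≢ 0 → νℕ p (a * b) ≡ νℕ p a + νℕ p b
  ν-* a b a≢0 b≢0 = ν-exact (HasValuation-* (ν-decomposes a a≢0) (ν-decomposes b b≢0))

  HasValuation-≥ : ∀ {n d} → n HasValuation d → p ^ d ≤ n
  HasValuation-≥ {d = d} (factor m p∤m refl) = m≤m*n (p ^ d) m {{≢-nonZero (p∤⇒≢0 p∤m)}}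

  HasValuation-< : ∀ {n d v} → n HasValuation d → n < p ^ v → d < v
  HasValuation-< {d = d} {v} n-val n<pᵛ with d <? v
  ... | yes d<v = d<v
  ... | no d≮v  = ⊥-elim (<⇒≱ n<pᵛ (≤-trans (^-monoʳ-≤ p (≮⇒≥ d≮v)) (HasValuation-≥ n-val)))

  HasValuation-split : ∀ {b d e} → b HasValuation e → d < e → ∃[ X ] p ∣ X × b ≡ p ^ d * X
  HasValuation-split {d = d} {e} (factor m _ refl) d<e = p ^ (e ∸ d) * m , p∣X , b≡pᵈX
    where
    p∣X : p ∣ p ^ (e ∸ d) * m
    p∣X with e ∸ d | m<n⇒0<n∸m d<e
    ... | suc k | _ = divides (p ^ k * m) (peel k m)
    b≡pᵈX : p ^ e * m ≡ p ^ d * (p ^ (e ∸ d) * m)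
    b≡pᵈX = begin
      p ^ e * m                        ≡⟨ cong (λ w → p ^ w * m) (sym (m+[n∸m]≡n (<⇒≤ d<e))) ⟩
      p ^ (d + (e ∸ d)) * m            ≡⟨ cong (_* m) (^-distribˡ-+-* p d (e ∸ d)) ⟩
      p ^ d * p ^ (e ∸ d) * m          ≡⟨ *-assoc (p ^ d) _ m ⟩
      p ^ d * (p ^ (e ∸ d) * m)        ∎
      where open ≡-Reasoning

  HasValuation-+ : ∀ {a b d e} → a HasValuation d → b HasValuation e → d < e →
                   (b + a) HasValuation d
  HasValuation-+ {d = d} (factor c p∤c refl) b-val d<e with HasValuation-split b-val d<e
  ... | X , p∣X , refl = factor (X + c) (λ p∣X+c → p∤c (∣m+n∣m⇒∣n p∣X+c p∣X))
                         (sym (*-distribˡ-+ (p ^ d) X c))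

  HasValuation-∸ : ∀ {a b d e} → a HasValuation d → b HasValuation e → d < e → a ≤ b →
                   (b ∸ a) HasValuation d
  HasValuation-∸ {d = d} (factor c p∤c refl) b-val d<e a≤b with HasValuation-split b-val d<e
  ... | X , p∣X , refl = factor (X ∸ c) p∤X∸c (sym (*-distribˡ-∸ (p ^ d) X c))
    where
    c≤X : c ≤ X
    c≤X = *-cancelˡ-≤ (p ^ d) {{m^n≢0 p d}} a≤b
    -- X = (X - c) + c with p ∣ X and p ∤ c
    p∤X∸c : ¬ (p ∣ X ∸ c)
    p∤X∸c p∣X∸c = p∤c (∣m+n∣m⇒∣n (subst (p ∣_) (sym (m∸n+n≡m c≤X)) p∣X) p∣X∸c)

  ν-1 : νℕ p 1 ≡ 0
  ν-1 = ν-exact (factor 1 p∤1 refl)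
    where
    p∤1 : ¬ (p ∣ 1)
    p∤1 p∣1 = <⇒≢ (nonTrivial⇒n>1 p) (sym (∣1⇒≡1 p∣1))

  ν-suc-! : ∀ s → νℕ p (suc s !) ≡ νℕ p (s !) + νℕ p (suc s)
  ν-suc-! s = trans (ν-* (suc s) (s !) (λ ()) (≢-nonZero⁻¹ (s !) {{s !≢0}}))
                    (+-comm (νℕ p (suc s)) (νℕ p (s !)))

module Quotient (p : ℕ) (p-prime : Prime p) where
  open import Data.Nat as ℕ using (NonZero; ≢-nonZero⁻¹)
  open import Data.Nat.Properties using (*-zeroʳ)
  open import Data.Nat.GCD using (gcd)
  open import Data.Integer using (ℤ; +_; ∣_∣; _-_)
  open import Data.Integer.Properties using (abs-*; pos-+; ∣i∣≡0⇒i≡0)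
  open import Data.Integer.Solver using (module +-*-Solver)
  open +-*-Solver using (solve; _:+_; _:-_; _:=_)
  open import Data.Rational using (_/_; ↥_; ↧_; ↧ₙ_)
  open import Data.Rational.Properties using (↥-/; ↧-/)
  open import Relation.Binary.PropositionalEquality
  open Valuation p p-prime using (ν-*)

  ν-difference-*ʳ : ∀ a b g → a ℕ.* g ≢ 0 → b ℕ.* g ≢ 0 →
                    + νℕ p (a ℕ.* g) - + νℕ p (b ℕ.* g) ≡ + νℕ p a - + νℕ p b
  ν-difference-*ʳ a b g ag≢0 bg≢0
    rewrite ν-* a g (λ { refl → ag≢0 refl }) (λ { refl → ag≢0 (*-zeroʳ a) })
          | ν-* b g (λ { refl → bg≢0 refl }) (λ { refl → bg≢0 (*-zeroʳ b) })
          | pos-+ (νℕ p a) (νℕ p g) | pos-+ (νℕ p b) (νℕ p g)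
    = solve 3 (λ x y z → (x :+ z) :- (y :+ z) := x :- y) refl (+ νℕ p a) (+ νℕ p b) (+ νℕ p g)

  -- The valuation of i / n is ν(i) - ν(n), although i / n is stored in lowest
  -- terms: numerator and denominator differ from i and n by the factor gcd(∣i∣, n).
  νℚ-/ : ∀ (i : ℤ) (n : ℕ) .{{_ : NonZero n}} → i ≢ + 0 →
         νℚ p (i / n) ≡ + νℕ p ∣ i ∣ - + νℕ p n
  νℚ-/ i n i≢0 = begin
    + νℕ p ∣ ↥ q ∣ - + νℕ p (↧ₙ q)                 ≡⟨ sym (ν-difference-*ʳ ∣ ↥ q ∣ (↧ₙ q) g num≢0 den≢0) ⟩
    + νℕ p (∣ ↥ q ∣ ℕ.* g) - + νℕ p (↧ₙ q ℕ.* g)   ≡⟨ cong₂ (λ x y → + νℕ p x - + νℕ p y) num den ⟩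
    + νℕ p ∣ i ∣ - + νℕ p n                        ∎
    where
    open ≡-Reasoning
    q = i / n
    g = gcd ∣ i ∣ n
    num : ∣ ↥ q ∣ ℕ.* g ≡ ∣ i ∣
    num = trans (sym (abs-* (↥ q) (+ g))) (cong ∣_∣ (↥-/ i n))
    den : ↧ₙ q ℕ.* g ≡ n
    den = trans (sym (abs-* (↧ q) (+ g))) (cong ∣_∣ (↧-/ i n))
    num≢0 : ∣ ↥ q ∣ ℕ.* g ≢ 0
    num≢0 e = i≢0 (∣i∣≡0⇒i≡0 (trans (sym num) e))
    den≢0 : ↧ₙ q ℕ.* g ≢ 0
    den≢0 e = ≢-nonZero⁻¹ n (trans (sym den) e)

module FallingFactorial (p : ℕ) (p-prime : Prime p) where
  open import Data.Nat as ℕ using (zero; suc; _<_; _!)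
  open import Data.Nat.Properties as ℕₚ using (+-suc; +-assoc; ≤-trans; <⇒≤)
  open import Data.Integer using (ℤ; +_; -[1+_]; ∣_∣; _*_; _-_)
  open import Data.Integer.Properties using (abs-*; ⊖-≥; ∣i∣≡0⇒i≡0; *-identityˡ; +-identityʳ)
  open import Relation.Binary.PropositionalEquality
  open import Data.Empty using (⊥-elim)
  open Valuation p p-prime

  -- Integer form of the ultrametric property: if ν(k) < ν(t) (and k ≤ ∣t∣,
  -- which only matters for t > 0), then t - k has valuation ν(k).
  HasValuation-ℤ- : ∀ t {k d e} → k HasValuation d → ∣ t ∣ HasValuation e → d < e →
                    k ℕ.≤ ∣ t ∣ → ∣ t - + k ∣ HasValuation d
  HasValuation-ℤ- t {zero} k-val _ _ _ = ⊥-elim (HasValuation⇒≢0 k-val refl)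
  HasValuation-ℤ- (+ n) {suc k} {d} k-val t-val d<e k≤n =
    subst (_HasValuation d) (cong ∣_∣ (sym (⊖-≥ k≤n))) (HasValuation-∸ k-val t-val d<e k≤n)
  HasValuation-ℤ- -[1+ n ] {suc k} {d} k-val t-val d<e _ =
    subst (_HasValuation d) (cong suc (+-suc n k)) (HasValuation-+ k-val t-val d<e)

  module _ (t : ℤ) (t≢0 : t ≢ + 0) where

    v : ℕ
    v = νℤ p t

    t-val : ∣ t ∣ HasValuation v
    t-val = ν-decomposes ∣ t ∣ (λ ∣t∣≡0 → t≢0 (∣i∣≡0⇒i≡0 ∣t∣≡0))

    factor-val : ∀ k → k ≢ 0 → k < p ℕ.^ v → ∣ t - + k ∣ HasValuation νℕ p k
    factor-val k k≢0 k<pᵛ =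
      HasValuation-ℤ- t k-val t-val (HasValuation-< k-val k<pᵛ)
                      (≤-trans (<⇒≤ k<pᵛ) (HasValuation-≥ t-val))
      where
      k-val : k HasValuation νℕ p k
      k-val = ν-decomposes k k≢0

    exponent-step : ∀ s → v ℕ.+ νℕ p (s !) ℕ.+ νℕ p (suc s) ≡ v ℕ.+ νℕ p (suc s !)
    exponent-step s = trans (+-assoc v _ _) (cong (v ℕ.+_) (sym (ν-suc-! s)))

    falling-val : ∀ s → suc s ℕ.≤ p ℕ.^ v → ∣ falling t (suc s) ∣ HasValuation (v ℕ.+ νℕ p (s !))
    falling-val zero _ =
      subst₂ _HasValuation_ (cong ∣_∣ (sym t≡))
             (sym (trans (cong (v ℕ.+_) ν-1) (ℕₚ.+-identityʳ v))) t-val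
      where
      t≡ : + 1 * (t - + 0) ≡ t
      t≡ = trans (*-identityˡ _) (+-identityʳ t)
    falling-val (suc s) s<pᵛ =
      subst₂ _HasValuation_ (sym (abs-* (falling t (suc s)) (t - + suc s))) (exponent-step s)
        (HasValuation-* (falling-val s (<⇒≤ s<pᵛ)) (factor-val (suc s) (λ ()) s<pᵛ))

    falling≢0 : ∀ S → 1 ℕ.≤ S → S ℕ.≤ p ℕ.^ v → falling t S ≢ + 0
    falling≢0 (suc s) _ S≤pᵛ F≡0 = HasValuation⇒≢0 (falling-val s S≤pᵛ) (cong ∣_∣ F≡0)

    ν-falling : ∀ S → 1 ℕ.≤ S → S ℕ.≤ p ℕ.^ v →
                νℕ p ∣ falling t S ∣ ℕ.+ νℕ p S ≡ v ℕ.+ νℕ p (S !)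
    ν-falling (suc s) _ S≤pᵛ =
      trans (cong (ℕ._+ νℕ p (suc s)) (ν-exact (falling-val s S≤pᵛ))) (exponent-step s)

open import Data.Nat using (_≤_; _^_)
open import Data.Integer using (ℤ; +_; _+_; _-_)
open import Data.Vec using (Vec; sum)
open import Relation.Binary.PropositionalEquality using (_≡_; _≢_)

rearrange : ∀ a s b c P → a Data.Nat.+ s ≡ b Data.Nat.+ c →
            + a - + P ≡ (+ b + (+ c - + P)) - + s
rearrange a s b c P a+s≡b+c = begin
  + a - + P                  ≡⟨ solve 3 (λ x y z → x :- z := ((x :+ y) :- z) :- y) refl (+ a) (+ s) (+ P) ⟩
  ((+ a + + s) - + P) - + s  ≡⟨ cong (λ w → (w - + P) - + s) sums ⟩
  ((+ b + + c) - + P) - + s  ≡⟨ cong (_- + s) (solve 3 (λ x y z → (x :+ y) :- z := x :+ (y :- z)) refl (+ b) (+ c) (+ P)) ⟩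
  (+ b + (+ c - + P)) - + s  ∎
  where
  open import Relation.Binary.PropositionalEquality using (refl; sym; trans; cong; module ≡-Reasoning)
  open import Data.Integer.Properties using (pos-+)
  open import Data.Integer.Solver using (module +-*-Solver)
  open +-*-Solver using (solve; _:+_; _:-_; _:=_)
  open ≡-Reasoning
  sums : + a + + s ≡ + b + + c
  sums = trans (sym (pos-+ a s)) (trans (cong +_ a+s≡b+c) (pos-+ b c))

lemma1p7 : (p : ℕ) → Prime p → (t : ℤ) → t ≢ + 0 → (r : ℕ) → (is : Vec ℕ r) →
    1 ≤ sum is → sum is ≤ p ^ νℤ p t →
    νℚ p (genMultinom t is) ≡ (+ νℤ p t + νℚ p (multinom is)) - + νℕ p (sum is)
lemma1p7 p p-prime t t≢0 r is 1≤S S≤pᵛ = begin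
  νℚ p (genMultinom t is)                      ≡⟨ νℚ-/ (falling t S) P (falling≢0 t t≢0 S 1≤S S≤pᵛ) ⟩
  + νℕ p ∣ falling t S ∣ - + νℕ p P             ≡⟨ rearrange _ _ _ _ (νℕ p P) (ν-falling t t≢0 S 1≤S S≤pᵛ) ⟩
  (+ νℤ p t + (+ νℕ p (S !) - + νℕ p P)) - + νℕ p S
                                               ≡⟨ cong (λ q → (+ νℤ p t + q) - + νℕ p S) (sym (νℚ-/ (+ (S !)) P S!≢0)) ⟩
  (+ νℤ p t + νℚ p (multinom is)) - + νℕ p S    ∎
  where
  open import Data.Nat using (_!; NonZero; ≢-nonZero⁻¹)
  open import Data.Nat.Properties using (_!≢0)
  open import Data.Integer using (∣_∣)
  open import Data.Integer.Properties using (+-injective)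
  open import Relation.Binary.PropositionalEquality using (cong; sym; module ≡-Reasoning)
  open ≡-Reasoning
  open Quotient p p-prime using (νℚ-/)
  open FallingFactorial p p-prime using (falling≢0; ν-falling)
  S : ℕ
  S = sum is
  P : ℕ
  P = prodFact is
  instance
    P≢0 : NonZero P
    P≢0 = prodFact≢0 is
  S!≢0 : + (S !) ≢ + 0
  S!≢0 e = ≢-nonZero⁻¹ (S !) {{S !≢0}} (+-injective e)
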